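{- Let $\ominus$ be the double minus operation on $\mathbb{R}$, $a\ominus b:=-a-b$. Then for all $n\ge1$, $s^{\mathrm{ac}}_n(\ominus)=(2^n-(-1)^n)/3$.
   Context: For $X_n=\{x_1,\dots,x_n\}$, groupoid terms are built recursively from variables by $(s,t)\mapsto(st)$; a full linear term over $X_n$ is a term in which each variable occurs exactly once. $s^{\mathrm{ac}}_n(\ominus)$ is the number of distinct $n$-ary term operations on $(\mathbb{R},\ominus)$ induced by full linear terms over $X_n$. -}

module Defs where

open import Level using (Level; _⊔_; suc)
open import Algebra.Bundles using (CommutativeRing)
open import Relation.Binary.Structures using (IsStrictTotalOrder)
open import Relation.Nullary using (¬_)
open import Data.Product using (Σ; ∃; _×_; _,_)
open import Data.Sum using (_⊎_)
open import Data.Nat using (ℕ)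
open import Data.Fin using (Fin)
open import Data.List using (List; []; _∷_; _++_; allFin)
open import Data.List.Relation.Binary.Permutation.Propositional using (_↭_)

-- Axiomatic real numbers: a complete ordered field (unique up to isomorphism).
record RealField (c ℓ : Level) : Set (suc (c ⊔ ℓ)) where
  field
    commRing : CommutativeRing c ℓ
  open CommutativeRing commRing public
  field
    _<_ : Carrier → Carrier → Set ℓ
    <-isStrictTotalOrder : IsStrictTotalOrder _≈_ _<_
    0≉1 : ¬ (0# ≈ 1#)
    +-mono-< : ∀ {x y} z → x < y → (x + z) < (y + z)
    *-pos : ∀ {x y} → 0# < x → 0# < y → 0# < (x * y)
    inverse : ∀ x → ¬ (x ≈ 0#) → ∃ λ y → (x * y) ≈ 1#
  _≤_ : Carrier → Carrier → Set ℓ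
  x ≤ y = (x < y) ⊎ (x ≈ y)
  field
    complete : (P : Carrier → Set (c ⊔ ℓ)) → ∃ P → (∃ λ b → ∀ x → P x → x ≤ b) →
               ∃ λ s → (∀ x → P x → x ≤ s) × (∀ b → (∀ x → P x → x ≤ b) → s ≤ b)

data Term (n : ℕ) : Set where
  var : Fin n → Term n
  _·_ : Term n → Term n → Term n

leaves : ∀ {n} → Term n → List (Fin n)
leaves (var i) = i ∷ []
leaves (s · t) = leaves s ++ leaves t

FullLinear : ℕ → Set
FullLinear n = Σ (Term n) λ t → leaves t ↭ allFin n

module _ {c ℓ} (R : RealField c ℓ) where
  open RealField R

  _⊖_ : Carrier → Carrier → Carrier
  a ⊖ b = (- a) - b

  eval : ∀ {n} → (Fin n → Carrier) → Term n → Carrier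
  eval v (var i) = v i
  eval v (s · t) = eval v s ⊖ eval v t

  SameOp : ∀ {n} → FullLinear n → FullLinear n → Set (c ⊔ ℓ)
  SameOp {n} (s , _) (t , _) = ∀ (v : Fin n → Carrier) → eval v s ≈ eval v t

{-# OPTIONS --safe #-}
-- A full linear term over (ℝ, ⊖) computes a signed sum Σ ±xᵢ, the sign of xᵢ being (−1)^(depth of xᵢ).
-- Call (#plus − #minus) mod 3 the charge of a sign vector. A variable has charge 1 and
-- charge (s · t) = −charge s − charge t, so every term has charge 1; conversely every sign vector of
-- charge 1 is realised by a term. Distinct sign vectors give distinct operations (evaluate at unit
-- vectors and use 1 ≠ −1), so s^ac_n is the number of sign vectors of charge 1, and the recurrence
-- N(n + 1, r) = N(n, r − 1) + N(n, r + 1) gives (2ⁿ − (−1)ⁿ)/3.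
module Submission where

open import Defs
open import Data.Nat using (ℕ; _≤_; _*_)
open import Data.Integer using (ℤ; +_; _-_; -[1+_])
open import Data.Product using (Σ; _×_)
open import Data.List using (List; length)
open import Data.List.Relation.Unary.Any using (Any)
open import Data.List.Relation.Unary.AllPairs using (AllPairs)
open import Relation.Nullary using (¬_)
open import Relation.Binary.PropositionalEquality using (_≡_)
import Data.Nat as N
import Data.Integer as Z

open import Algebra.Bundles using (Ring)
open import Data.Bool using (Bool; true; false; not)
open import Data.Bool.Properties using (not-involutive)
open import Data.Empty using (⊥-elim)
open import Data.Fin as Fin using (Fin; zero; suc)
open import Data.Integer.Tactic.RingSolver using (solve-∀)
open import Data.List using ([]; _∷_; _++_; map; foldr; tabulate; allFin)
open import Data.List.Properties using (length-++; length-map; map-++; map-tabulate; map-cong-local; foldr-++; foldr-map; ++-identityʳ)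
open import Data.List.Relation.Binary.Permutation.Propositional as ↭ using (_↭_; ↭-refl; ↭-prep; ↭-swap; ↭-trans; ↭-sym; ↭⇒↭ₛ′; module PermutationReasoning)
open import Data.List.Relation.Binary.Permutation.Propositional.Properties using (shift; map⁺)
import Data.List.Relation.Binary.Permutation.Setoid.Properties as SetoidPermutation
open import Data.List.Relation.Unary.All as All using (All; []; _∷_)
import Data.List.Relation.Unary.All.Properties as All
open import Data.List.Relation.Unary.AllPairs as AllPairs using ([]; _∷_)
import Data.List.Relation.Unary.AllPairs.Properties as AllPairs
open import Data.List.Relation.Unary.Any as Any using (here)
import Data.List.Relation.Unary.Any.Properties as Any
open import Data.List.Relation.Unary.Unique.Propositional using (Unique)
open import Data.List.Relation.Unary.Unique.Propositional.Properties using (allFin⁺)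
open import Data.Product using (∃; _,_; proj₁; proj₂)
import Data.Product as Product
open import Data.Vec using (Vec; []; _∷_; lookup)
import Data.Vec as Vec
open import Function using (_∘_; _on_; id)
open import Relation.Binary.Definitions using (tri<; tri≈; tri>)
open import Relation.Binary.PropositionalEquality using (_≢_; cong; cong₂; subst; subst₂; module ≡-Reasoning)
import Relation.Binary.PropositionalEquality as ≡
open import Relation.Binary.Structures using (IsStrictTotalOrder)
open import Relation.Nullary using (yes; no)
import Algebra.Properties.Ring as RingProperties
import Data.Integer.Properties as Z
import Data.Nat.Properties as N

private
  variable
    n : ℕ

data ℤ₃ : Set where
  0₃ 1₃ 2₃ : ℤ₃

suc₃ pred₃ -₃_ : ℤ₃ → ℤ₃
suc₃ 0₃ = 1₃
suc₃ 1₃ = 2₃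
suc₃ 2₃ = 0₃
pred₃ 0₃ = 2₃
pred₃ 1₃ = 0₃
pred₃ 2₃ = 1₃
-₃ 0₃ = 0₃
-₃ 1₃ = 2₃
-₃ 2₃ = 1₃

suc₃-pred₃ : ∀ r → suc₃ (pred₃ r) ≡ r
suc₃-pred₃ 0₃ = ≡.refl
suc₃-pred₃ 1₃ = ≡.refl
suc₃-pred₃ 2₃ = ≡.refl

pred₃-suc₃ : ∀ r → pred₃ (suc₃ r) ≡ r
pred₃-suc₃ 0₃ = ≡.refl
pred₃-suc₃ 1₃ = ≡.refl
pred₃-suc₃ 2₃ = ≡.refl

-₃-involutive : ∀ r → -₃ -₃ r ≡ r
-₃-involutive 0₃ = ≡.refl
-₃-involutive 1₃ = ≡.refl
-₃-involutive 2₃ = ≡.refl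

-₃suc₃suc₃-₃ : ∀ r → -₃ suc₃ (suc₃ (-₃ r)) ≡ suc₃ r
-₃suc₃suc₃-₃ 0₃ = ≡.refl
-₃suc₃suc₃-₃ 1₃ = ≡.refl
-₃suc₃suc₃-₃ 2₃ = ≡.refl

suc₃³≡1₃ : ∀ r → suc₃ (suc₃ (suc₃ r)) ≡ 1₃ → r ≡ 1₃
suc₃³≡1₃ 1₃ ≡.refl = ≡.refl

pred₃-₃≡1₃ : ∀ r → pred₃ (-₃ r) ≡ 1₃ → r ≡ 1₃
pred₃-₃≡1₃ 1₃ ≡.refl = ≡.refl

rotate : Bool → ℤ₃ → ℤ₃
rotate true = suc₃
rotate false = pred₃

rotate-comm : ∀ a b r → rotate a (rotate b r) ≡ rotate b (rotate a r)
rotate-comm true true r = ≡.refl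
rotate-comm false false r = ≡.refl
rotate-comm true false r = ≡.trans (suc₃-pred₃ r) (≡.sym (pred₃-suc₃ r))
rotate-comm false true r = ≡.trans (pred₃-suc₃ r) (≡.sym (suc₃-pred₃ r))

rotate-not : ∀ b r → rotate (not b) (-₃ r) ≡ -₃ rotate b r
rotate-not true 0₃ = ≡.refl
rotate-not true 1₃ = ≡.refl
rotate-not true 2₃ = ≡.refl
rotate-not false 0₃ = ≡.refl
rotate-not false 1₃ = ≡.refl
rotate-not false 2₃ = ≡.refl

charge : Vec Bool n → ℤ₃
charge [] = 0₃
charge (b ∷ σ) = rotate b (charge σ)

Charged : ℕ → ℤ₃ → Set
Charged n r = Σ (Vec Bool n) λ σ → charge σ ≡ r

cons⁺ : ∀ {r} → Charged n (pred₃ r) → Charged (N.suc n) r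
cons⁺ {r = r} (σ , h) = true ∷ σ , ≡.trans (cong suc₃ h) (suc₃-pred₃ r)

cons⁻ : ∀ {r} → Charged n (suc₃ r) → Charged (N.suc n) r
cons⁻ {r = r} (σ , h) = false ∷ σ , ≡.trans (cong pred₃ h) (pred₃-suc₃ r)

charged : ∀ n r → List (Charged n r)
charged N.zero 0₃ = ([] , ≡.refl) ∷ []
charged N.zero 1₃ = []
charged N.zero 2₃ = []
charged (N.suc n) r = map cons⁺ (charged n (pred₃ r)) ++ map cons⁻ (charged n (suc₃ r))

charged-complete : ∀ {n r} (σ : Vec Bool n) → charge σ ≡ r → Any ((σ ≡_) ∘ proj₁) (charged n r)
charged-complete [] ≡.refl = here ≡.refl
charged-complete (true ∷ σ) ≡.refl =
  Any.++⁺ˡ (Any.map⁺ (Any.map (cong (true ∷_)) (charged-complete σ (≡.sym (pred₃-suc₃ _)))))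
charged-complete {r = r} (false ∷ σ) ≡.refl =
  Any.++⁺ʳ (map cons⁺ (charged _ (pred₃ r)))
    (Any.map⁺ (Any.map (cong (false ∷_)) (charged-complete σ (≡.sym (suc₃-pred₃ _)))))

Differ : Vec Bool n → Vec Bool n → Set
Differ σ τ = ∃ λ i → lookup σ i ≢ lookup τ i

charged-distinct : ∀ n r → AllPairs (Differ on proj₁) (charged n r)
charged-distinct N.zero 0₃ = [] ∷ []
charged-distinct N.zero 1₃ = []
charged-distinct N.zero 2₃ = []
charged-distinct (N.suc n) r =
  AllPairs.++⁺ (AllPairs.map⁺ (AllPairs.map differ-tail (charged-distinct n (pred₃ r))))
               (AllPairs.map⁺ (AllPairs.map differ-tail (charged-distinct n (suc₃ r))))
               (All.map⁺ (All.universal (λ _ → All.map⁺ (All.universal (λ _ → zero , λ ()) _)) _))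
  where
  differ-tail : ∀ {b} {σ τ : Vec Bool n} → Differ σ τ → Differ (b ∷ σ) (b ∷ τ)
  differ-tail (i , d) = suc i , d

weight : ℤ₃ → ℤ
weight 0₃ = Z.- + 2
weight 1₃ = + 1
weight 2₃ = + 1

weight-suc₃ : ∀ r → weight (suc₃ r) ≡ Z.- weight r - weight (pred₃ r)
weight-suc₃ 0₃ = ≡.refl
weight-suc₃ 1₃ = ≡.refl
weight-suc₃ 2₃ = ≡.refl

length-charged : ∀ n r →
  length (charged (N.suc n) r) ≡ length (charged n (pred₃ r)) N.+ length (charged n (suc₃ r))
length-charged n r = ≡.trans (length-++ (map cons⁺ (charged n (pred₃ r))))
  (cong₂ N._+_ (length-map cons⁺ (charged n (pred₃ r))) (length-map cons⁻ (charged n (suc₃ r))))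

3*length-charged : ∀ n r →
  + (3 * length (charged n r)) ≡ + (2 N.^ n) - Z.-1ℤ Z.^ n Z.* weight r
3*length-charged N.zero 0₃ = ≡.refl
3*length-charged N.zero 1₃ = ≡.refl
3*length-charged N.zero 2₃ = ≡.refl
3*length-charged (N.suc n) r = begin
  + (3 * length (charged (N.suc n) r))        ≡⟨ cong (λ k → + (3 * k)) (length-charged n r) ⟩
  + (3 * (a N.+ b))                           ≡⟨ cong +_ (N.*-distribˡ-+ 3 a b) ⟩
  + (3 * a N.+ 3 * b)                         ≡⟨ Z.pos-+ (3 * a) (3 * b) ⟩
  + (3 * a) Z.+ + (3 * b)                     ≡⟨ cong₂ Z._+_ (3*length-charged n (pred₃ r)) (3*length-charged n (suc₃ r)) ⟩
  (P - e Z.* weight (pred₃ r)) Z.+ (P - e Z.* weight (suc₃ r))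
    ≡⟨ cong (λ w → (P - e Z.* weight (pred₃ r)) Z.+ (P - e Z.* w)) (weight-suc₃ r) ⟩
  (P - e Z.* weight (pred₃ r)) Z.+ (P - e Z.* (Z.- weight r - weight (pred₃ r)))
    ≡⟨ recurrence P e (weight (pred₃ r)) (weight r) ⟩
  + 2 Z.* P - (Z.-1ℤ Z.* e) Z.* weight r      ≡⟨ cong (λ x → x - (Z.-1ℤ Z.* e) Z.* weight r) (Z.pos-* 2 (2 N.^ n)) ⟨
  + (2 N.^ N.suc n) - Z.-1ℤ Z.^ N.suc n Z.* weight r ∎
  where
  open ≡-Reasoning
  a b : ℕ
  a = length (charged n (pred₃ r))
  b = length (charged n (suc₃ r))
  P e : ℤ
  P = + (2 N.^ n)
  e = Z.-1ℤ Z.^ n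
  recurrence : ∀ P e u w → (P - e Z.* u) Z.+ (P - e Z.* (Z.- w - u)) ≡ + 2 Z.* P - (Z.-1ℤ Z.* e) Z.* w
  recurrence = solve-∀

-- Signed linear forms Σ ±xᵢ, as lists of (sign, variable) with true for +.
Form : ℕ → Set
Form n = List (Bool × Fin n)

negate : Form n → Form n
negate = map (Product.map₁ not)

rename : ∀ {m} → (Fin n → Fin m) → Form n → Form m
rename ρ = map (Product.map₂ ρ)

vars : Form n → List (Fin n)
vars = map proj₂

pos neg : List (Fin n) → Form n
pos = map (true ,_)
neg = negate ∘ pos

diag : Vec Bool n → Form n
diag [] = []
diag (b ∷ σ) = (b , zero) ∷ rename suc (diag σ)

negate-involutive : (A : Form n) → negate (negate A) ≡ A
negate-involutive [] = ≡.refl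
negate-involutive ((b , i) ∷ A) = cong₂ _∷_ (cong (_, i) (not-involutive b)) (negate-involutive A)

vars-negate : (A : Form n) → vars (negate A) ≡ vars A
vars-negate [] = ≡.refl
vars-negate ((b , i) ∷ A) = cong (i ∷_) (vars-negate A)

vars-rename : ∀ {m} (ρ : Fin n → Fin m) (A : Form n) → vars (rename ρ A) ≡ map ρ (vars A)
vars-rename ρ [] = ≡.refl
vars-rename ρ ((b , i) ∷ A) = cong (ρ i ∷_) (vars-rename ρ A)

vars-diag : (σ : Vec Bool n) → vars (diag σ) ≡ allFin n
vars-diag [] = ≡.refl
vars-diag {N.suc n} (b ∷ σ) = cong (zero ∷_) (begin
  vars (rename suc (diag σ)) ≡⟨ vars-rename suc (diag σ) ⟩
  map suc (vars (diag σ))    ≡⟨ cong (map suc) (vars-diag σ) ⟩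
  map suc (allFin n)         ≡⟨ map-tabulate id suc ⟩
  tabulate suc               ∎)
  where open ≡-Reasoning

diag-tabulate : (f : Fin n → Bool) → diag (Vec.tabulate f) ≡ tabulate (λ i → f i , i)
diag-tabulate {N.zero} f = ≡.refl
diag-tabulate {N.suc n} f = cong ((f zero , zero) ∷_)
  (≡.trans (cong (rename suc) (diag-tabulate (f ∘ suc)))
           (map-tabulate (λ i → f (suc i) , i) (Product.map₂ suc)))

positives negatives : Form n → List (Fin n)
positives [] = []
positives ((true , i) ∷ A) = i ∷ positives A
positives ((false , i) ∷ A) = positives A
negatives [] = []
negatives ((true , i) ∷ A) = negatives A
negatives ((false , i) ∷ A) = i ∷ negatives A

split-↭ : (A : Form n) → A ↭ pos (positives A) ++ neg (negatives A)
split-↭ [] = ↭-refl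
split-↭ ((true , i) ∷ A) = ↭-prep (true , i) (split-↭ A)
split-↭ ((false , i) ∷ A) =
  ↭-trans (↭-prep (false , i) (split-↭ A)) (↭-sym (shift (false , i) (pos (positives A)) (neg (negatives A))))

-- wind A 0₃ is (#positive − #negative entries of A) mod 3; the accumulator r lets it compose along _++_.
wind : Form n → ℤ₃ → ℤ₃
wind A r = foldr (rotate ∘ proj₁) r A

wind-++ : (A B : Form n) (r : ℤ₃) → wind (A ++ B) r ≡ wind A (wind B r)
wind-++ A B r = foldr-++ (rotate ∘ proj₁) r A B

wind-↭ : ∀ {A B : Form n} r → A ↭ B → wind A r ≡ wind B r
wind-↭ r ↭.refl = ≡.refl
wind-↭ r (↭.prep (b , _) p) = cong (rotate b) (wind-↭ r p)
wind-↭ r (↭.swap (a , _) (b , _) p) = ≡.trans (rotate-comm a b _) (cong (rotate b ∘ rotate a) (wind-↭ r p))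
wind-↭ r (↭.trans p q) = ≡.trans (wind-↭ r p) (wind-↭ r q)

wind-negate : (A : Form n) (r : ℤ₃) → wind (negate A) r ≡ -₃ wind A (-₃ r)
wind-negate [] r = ≡.sym (-₃-involutive r)
wind-negate ((b , _) ∷ A) r = ≡.trans (cong (rotate (not b)) (wind-negate A r)) (rotate-not b _)

wind-rename : ∀ {m} (ρ : Fin n → Fin m) (A : Form n) (r : ℤ₃) → wind (rename ρ A) r ≡ wind A r
wind-rename ρ A r = foldr-map (rotate ∘ proj₁) (Product.map₂ ρ) r A

wind-diag : (σ : Vec Bool n) → wind (diag σ) 0₃ ≡ charge σ
wind-diag [] = ≡.refl
wind-diag (b ∷ σ) = cong (rotate b) (≡.trans (wind-rename suc (diag σ) 0₃) (wind-diag σ))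

form : Term n → Form n
form (var i) = (true , i) ∷ []
form (s · t) = negate (form s) ++ negate (form t)

leaves≡vars-form : (t : Term n) → leaves t ≡ vars (form t)
leaves≡vars-form (var i) = ≡.refl
leaves≡vars-form (s · t) = ≡.trans
  (cong₂ _++_ (≡.trans (leaves≡vars-form s) (≡.sym (vars-negate (form s))))
              (≡.trans (leaves≡vars-form t) (≡.sym (vars-negate (form t)))))
  (≡.sym (map-++ proj₂ (negate (form s)) (negate (form t))))

-- The invariant: (−1) + (−1) ≡ 1 (mod 3).
wind-form : (t : Term n) (r : ℤ₃) → wind (form t) r ≡ suc₃ r
wind-form (var i) r = ≡.refl
wind-form (s · t) r = begin
  wind (negate (form s) ++ negate (form t)) r       ≡⟨ wind-++ (negate (form s)) (negate (form t)) r ⟩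
  wind (negate (form s)) (wind (negate (form t)) r) ≡⟨ wind-negate (form s) _ ⟩
  -₃ wind (form s) (-₃ wind (negate (form t)) r)    ≡⟨ cong (λ x → -₃ wind (form s) (-₃ x)) (wind-negate (form t) r) ⟩
  -₃ wind (form s) (-₃ -₃ wind (form t) (-₃ r))     ≡⟨ cong (λ x → -₃ wind (form s) x) (-₃-involutive _) ⟩
  -₃ wind (form s) (wind (form t) (-₃ r))           ≡⟨ cong (λ x → -₃ wind (form s) x) (wind-form t (-₃ r)) ⟩
  -₃ wind (form s) (suc₃ (-₃ r))                    ≡⟨ cong -₃_ (wind-form s _) ⟩
  -₃ suc₃ (suc₃ (-₃ r))                             ≡⟨ -₃suc₃suc₃-₃ r ⟩
  suc₃ r                                            ∎
  where open ≡-Reasoning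

leaves↭allFin : (t : Term n) {σ : Vec Bool n} → form t ↭ diag σ → leaves t ↭ allFin n
leaves↭allFin t {σ} form↭ = subst₂ _↭_ (≡.sym (leaves≡vars-form t)) (vars-diag σ) (map⁺ proj₂ form↭)

-- Realisation by the gadgets (x · y) · (z · u) = x + y + z + u and y · (x · u) = −y + x + u.
positiveTerm : (P : List (Fin n)) → wind (pos P) 0₃ ≡ 1₃ → Term n
positiveTerm [] ()
positiveTerm (x ∷ []) _ = var x
positiveTerm (x ∷ y ∷ []) ()
positiveTerm (x ∷ y ∷ z ∷ P) h = (var x · var y) · (var z · positiveTerm P (suc₃³≡1₃ _ h))

form-positiveTerm : (P : List (Fin n)) (h : wind (pos P) 0₃ ≡ 1₃) → form (positiveTerm P h) ↭ pos P
form-positiveTerm (x ∷ []) _ = ↭-refl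
form-positiveTerm (x ∷ y ∷ z ∷ P) h = ↭-prep _ (↭-prep _ (↭-prep _
  (subst (_↭ pos P) (≡.sym (negate-involutive _)) (form-positiveTerm P (suc₃³≡1₃ _ h)))))

linearTerm : (P M : List (Fin n)) → wind (pos P ++ neg M) 0₃ ≡ 1₃ → Term n
linearTerm P [] h = positiveTerm P (≡.trans (cong (λ A → wind A 0₃) (≡.sym (++-identityʳ (pos P)))) h)
linearTerm [] (y ∷ M) h = var y · positiveTerm M (pred₃-₃≡1₃ _ wind-M)
  where
  wind-M : pred₃ (-₃ wind (pos M) 0₃) ≡ 1₃
  wind-M = ≡.trans (cong pred₃ (≡.sym (wind-negate (pos M) 0₃))) h
linearTerm (x ∷ P) (y ∷ M) h = var y · (var x · linearTerm P M wind-PM)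
  where
  wind-PM : wind (pos P ++ neg M) 0₃ ≡ 1₃
  wind-PM = begin
    wind (pos P ++ neg M) 0₃                          ≡⟨ suc₃-pred₃ _ ⟨
    suc₃ (wind ((false , y) ∷ pos P ++ neg M) 0₃)     ≡⟨ cong suc₃ (wind-↭ 0₃ (shift (false , y) (pos P) (neg M))) ⟨
    wind (pos (x ∷ P) ++ neg (y ∷ M)) 0₃              ≡⟨ h ⟩
    1₃                                                ∎
    where open ≡-Reasoning

form-linearTerm : (P M : List (Fin n)) (h : wind (pos P ++ neg M) 0₃ ≡ 1₃) →
                  form (linearTerm P M h) ↭ pos P ++ neg M
form-linearTerm P [] h =
  subst (form (linearTerm P [] h) ↭_) (≡.sym (++-identityʳ (pos P))) (form-positiveTerm P _)
form-linearTerm [] (y ∷ M) h = ↭-prep (false , y) (map⁺ (Product.map₁ not) (form-positiveTerm M _))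
form-linearTerm (x ∷ P) (y ∷ M) h =
  ↭-trans (↭-swap (false , y) (true , x)
          (subst (_↭ pos P ++ neg M) (≡.sym (negate-involutive _)) (form-linearTerm P M _)))
        (↭-prep (true , x) (↭-sym (shift (false , y) (pos P) (neg M))))

realize : (A : Form n) → wind A 0₃ ≡ 1₃ → Term n
realize A h = linearTerm (positives A) (negatives A) (≡.trans (≡.sym (wind-↭ 0₃ (split-↭ A))) h)

form-realize : (A : Form n) (h : wind A 0₃ ≡ 1₃) → form (realize A h) ↭ A
form-realize A h = ↭-trans (form-linearTerm (positives A) (negatives A) _) (↭-sym (split-↭ A))

-- Junk value true when i does not occur in A.
signAt : Form n → Fin n → Bool
signAt [] i = true
signAt ((b , j) ∷ A) i with i Fin.≟ j
... | yes _ = b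
... | no _ = signAt A i

signAt-here : ∀ b j (A : Form n) → signAt ((b , j) ∷ A) j ≡ b
signAt-here b j A with j Fin.≟ j
... | yes _ = ≡.refl
... | no j≢j = ⊥-elim (j≢j ≡.refl)

signAt-there : ∀ b {j k} (A : Form n) → j ≢ k → signAt ((b , j) ∷ A) k ≡ signAt A k
signAt-there b {j} {k} A j≢k with k Fin.≟ j
... | yes k≡j = ⊥-elim (j≢k (≡.sym k≡j))
... | no _ = ≡.refl

map-signAt-vars : (A : Form n) → Unique (vars A) → map (λ i → signAt A i , i) (vars A) ≡ A
map-signAt-vars [] _ = ≡.refl
map-signAt-vars ((b , j) ∷ A) (j∉A ∷ uniq) = cong₂ _∷_ (cong (_, j) (signAt-here b j A)) (begin
  map (λ i → signAt ((b , j) ∷ A) i , i) (vars A)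
    ≡⟨ map-cong-local (All.map (λ j≢k → cong (_, _) (signAt-there b A j≢k)) j∉A) ⟩
  map (λ i → signAt A i , i) (vars A) ≡⟨ map-signAt-vars A uniq ⟩
  A                                    ∎)
  where open ≡-Reasoning

↭diag-signAt : (A : Form n) → vars A ↭ allFin n → A ↭ diag (Vec.tabulate (signAt A))
↭diag-signAt {n} A vars↭ = begin
  A                                  ≡⟨ map-signAt-vars A uniq ⟨
  map signedVar (vars A)             ↭⟨ map⁺ signedVar vars↭ ⟩
  map signedVar (allFin n)           ≡⟨ map-tabulate id signedVar ⟩
  tabulate signedVar                 ≡⟨ diag-tabulate (signAt A) ⟨
  diag (Vec.tabulate (signAt A))     ∎
  where
  open PermutationReasoning
  signedVar : Fin n → Bool × Fin n
  signedVar i = signAt A i , i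
  uniq : Unique (vars A)
  uniq = SetoidPermutation.Unique-resp-↭ (≡.setoid (Fin n))
           (↭⇒↭ₛ′ ≡.isEquivalence (↭-sym vars↭)) (allFin⁺ n)

record _HasSigns_ (t : FullLinear n) (σ : Vec Bool n) : Set where
  constructor hasSigns
  field form↭diag : form (proj₁ t) ↭ diag σ

open _HasSigns_

signsOf : FullLinear n → Vec Bool n
signsOf (t , _) = Vec.tabulate (signAt (form t))

hasSigns-signsOf : (t : FullLinear n) → t HasSigns signsOf t
hasSigns-signsOf {n} (t , leaves↭) =
  hasSigns (↭diag-signAt (form t) (subst (_↭ allFin n) (leaves≡vars-form t) leaves↭))

charge-signsOf : (t : FullLinear n) → charge (signsOf t) ≡ 1₃
charge-signsOf t = begin
  charge (signsOf t)          ≡⟨ wind-diag (signsOf t) ⟨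
  wind (diag (signsOf t)) 0₃  ≡⟨ wind-↭ 0₃ (form↭diag (hasSigns-signsOf t)) ⟨
  wind (form (proj₁ t)) 0₃    ≡⟨ wind-form (proj₁ t) 0₃ ⟩
  1₃                          ∎
  where open ≡-Reasoning

termWithSigns : Charged n 1₃ → FullLinear n
termWithSigns {n} (σ , h) = t , leaves↭allFin t (form-realize (diag σ) wind≡1₃)
  where
  wind≡1₃ : wind (diag σ) 0₃ ≡ 1₃
  wind≡1₃ = ≡.trans (wind-diag σ) h
  t : Term n
  t = realize (diag σ) wind≡1₃

hasSigns-termWithSigns : (q : Charged n 1₃) → termWithSigns q HasSigns proj₁ q
hasSigns-termWithSigns (σ , h) = hasSigns (form-realize (diag σ) _)

module FormSemantics {c ℓ} (R : Ring c ℓ) where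
  open Ring R hiding (zero)
  open RingProperties R using (-‿involutive; -‿+-comm; -0#≈0#)
  open import Relation.Binary.Reasoning.Setoid setoid

  signed : Bool → Carrier → Carrier
  signed true x = x
  signed false x = - x

  ⟦_⟧ : Form n → (Fin n → Carrier) → Carrier
  ⟦ A ⟧ v = foldr _+_ 0# (map (λ (b , i) → signed b (v i)) A)

  ⟦⟧-++ : (A B : Form n) (v : Fin n → Carrier) → ⟦ A ++ B ⟧ v ≈ ⟦ A ⟧ v + ⟦ B ⟧ v
  ⟦⟧-++ [] B v = sym (+-identityˡ _)
  ⟦⟧-++ ((b , i) ∷ A) B v = trans (+-congˡ (⟦⟧-++ A B v)) (sym (+-assoc _ _ _))

  signed-not : ∀ b x → signed (not b) x ≈ - signed b x
  signed-not true x = refl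
  signed-not false x = sym (-‿involutive x)

  ⟦⟧-negate : (A : Form n) (v : Fin n → Carrier) → ⟦ negate A ⟧ v ≈ - ⟦ A ⟧ v
  ⟦⟧-negate [] v = sym -0#≈0#
  ⟦⟧-negate ((b , i) ∷ A) v = trans (+-cong (signed-not b (v i)) (⟦⟧-negate A v)) (-‿+-comm _ _)

  ⟦⟧-↭ : {A B : Form n} (v : Fin n → Carrier) → A ↭ B → ⟦ A ⟧ v ≈ ⟦ B ⟧ v
  ⟦⟧-↭ v A↭B = SetoidPermutation.foldr-commMonoid setoid +-isCommutativeMonoid
    (↭⇒↭ₛ′ isEquivalence (map⁺ (λ (b , i) → signed b (v i)) A↭B))

  ⟦⟧-rename : ∀ {m} (ρ : Fin n → Fin m) (A : Form n) (v : Fin m → Carrier) →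
              ⟦ rename ρ A ⟧ v ≈ ⟦ A ⟧ (v ∘ ρ)
  ⟦⟧-rename ρ [] v = refl
  ⟦⟧-rename ρ ((b , i) ∷ A) v = +-congˡ (⟦⟧-rename ρ A v)

  signed-0# : ∀ b → signed b 0# ≈ 0#
  signed-0# true = refl
  signed-0# false = -0#≈0#

  ⟦⟧-0 : (A : Form n) → ⟦ A ⟧ (λ _ → 0#) ≈ 0#
  ⟦⟧-0 [] = refl
  ⟦⟧-0 ((b , i) ∷ A) = trans (+-cong (signed-0# b) (⟦⟧-0 A)) (+-identityˡ 0#)

  unit : Fin n → Fin n → Carrier
  unit zero zero = 1#
  unit zero (suc _) = 0#
  unit (suc i) zero = 0#
  unit (suc i) (suc j) = unit i j

  ⟦diag⟧-unit : (σ : Vec Bool n) (i : Fin n) → ⟦ diag σ ⟧ (unit i) ≈ signed (lookup σ i) 1#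
  ⟦diag⟧-unit (b ∷ σ) zero =
    trans (+-congˡ (trans (⟦⟧-rename suc (diag σ) (unit zero)) (⟦⟧-0 (diag σ)))) (+-identityʳ _)
  ⟦diag⟧-unit (b ∷ σ) (suc i) = begin
    signed b 0# + ⟦ rename suc (diag σ) ⟧ (unit (suc i)) ≈⟨ +-congˡ (⟦⟧-rename suc (diag σ) (unit (suc i))) ⟩
    signed b 0# + ⟦ diag σ ⟧ (unit i)                    ≈⟨ +-cong (signed-0# b) (⟦diag⟧-unit σ i) ⟩
    0# + signed (lookup σ i) 1#                          ≈⟨ +-identityˡ _ ⟩
    signed (lookup σ i) 1#                               ∎

  signed-1#-injective : ¬ (1# ≈ - 1#) → ∀ {a b} → a ≢ b → ¬ (signed a 1# ≈ signed b 1#)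
  signed-1#-injective 1≉-1 {true} {true} a≢b _ = a≢b ≡.refl
  signed-1#-injective 1≉-1 {false} {false} a≢b _ = a≢b ≡.refl
  signed-1#-injective 1≉-1 {true} {false} _ = 1≉-1
  signed-1#-injective 1≉-1 {false} {true} _ = 1≉-1 ∘ sym

  diag-separates : ¬ (1# ≈ - 1#) → (σ τ : Vec Bool n) → Differ σ τ →
                   ¬ (∀ v → ⟦ diag σ ⟧ v ≈ ⟦ diag τ ⟧ v)
  diag-separates 1≉-1 σ τ (i , σᵢ≢τᵢ) same = signed-1#-injective 1≉-1 σᵢ≢τᵢ (begin
    signed (lookup σ i) 1# ≈⟨ ⟦diag⟧-unit σ i ⟨
    ⟦ diag σ ⟧ (unit i)    ≈⟨ same (unit i) ⟩
    ⟦ diag τ ⟧ (unit i)    ≈⟨ ⟦diag⟧-unit τ i ⟩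
    signed (lookup τ i) 1# ∎)

module _ {c ℓ} (R : RealField c ℓ) where
  open RealField R renaming (_*_ to _*ᴿ_)
  open FormSemantics ring
  open RingProperties ring using (-1*x≈-x; -‿involutive)
  open IsStrictTotalOrder <-isStrictTotalOrder using (compare; irrefl; <-respˡ-≈; <-respʳ-≈) renaming (trans to <-trans)
  open import Relation.Binary.Reasoning.Setoid setoid

  0<-x : ∀ {x} → x < 0# → 0# < (- x)
  0<-x {x} x<0 = <-respʳ-≈ (+-identityˡ (- x)) (<-respˡ-≈ (-‿inverseʳ x) (+-mono-< (- x) x<0))

  0<1 : 0# < 1#
  0<1 with compare 0# 1#
  ... | tri< lt _ _ = lt
  ... | tri≈ _ 0≈1 _ = ⊥-elim (0≉1 0≈1)
  ... | tri> _ _ 1<0 = ⊥-elim (irrefl refl (<-trans 1<0 (<-respʳ-≈ -1*-1≈1 (*-pos 0<-1 0<-1))))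
    where
    0<-1 : 0# < (- 1#)
    0<-1 = 0<-x 1<0
    -1*-1≈1 : (- 1#) *ᴿ (- 1#) ≈ 1#
    -1*-1≈1 = trans (-1*x≈-x (- 1#)) (-‿involutive 1#)

  1≉-1 : ¬ (1# ≈ - 1#)
  1≉-1 1≈-1 = irrefl refl (<-trans 0<1 1<0)
    where
    1<0 : 1# < 0#
    1<0 = <-respʳ-≈ (trans (+-congʳ 1≈-1) (-‿inverseˡ 1#)) (<-respˡ-≈ (+-identityˡ 1#) (+-mono-< 1# 0<1))

  eval≈⟦form⟧ : (v : Fin n → Carrier) (t : Term n) → eval R v t ≈ ⟦ form t ⟧ v
  eval≈⟦form⟧ v (var i) = sym (+-identityʳ (v i))
  eval≈⟦form⟧ v (s · t) = begin
    - eval R v s + - eval R v t                 ≈⟨ +-cong (-‿cong (eval≈⟦form⟧ v s)) (-‿cong (eval≈⟦form⟧ v t)) ⟩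
    - ⟦ form s ⟧ v + - ⟦ form t ⟧ v             ≈⟨ +-cong (⟦⟧-negate (form s) v) (⟦⟧-negate (form t) v) ⟨
    ⟦ negate (form s) ⟧ v + ⟦ negate (form t) ⟧ v ≈⟨ ⟦⟧-++ (negate (form s)) (negate (form t)) v ⟨
    ⟦ form (s · t) ⟧ v                          ∎

  eval≈⟦diag⟧ : {t : FullLinear n} {σ : Vec Bool n} → t HasSigns σ →
                (v : Fin n → Carrier) → eval R v (proj₁ t) ≈ ⟦ diag σ ⟧ v
  eval≈⟦diag⟧ {t = t , _} (hasSigns form↭) v = trans (eval≈⟦form⟧ v t) (⟦⟧-↭ v form↭)

  sameOp-if-sameSigns : {s t : FullLinear n} {σ : Vec Bool n} → s HasSigns σ → t HasSigns σ → SameOp R s t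
  sameOp-if-sameSigns s∼σ t∼σ v = trans (eval≈⟦diag⟧ s∼σ v) (sym (eval≈⟦diag⟧ t∼σ v))

  ¬sameOp-if-differ : {s t : FullLinear n} {σ τ : Vec Bool n} →
                      s HasSigns σ → t HasSigns τ → Differ σ τ → ¬ SameOp R s t
  ¬sameOp-if-differ {σ = σ} {τ} s∼σ t∼τ σ≠τ same = diag-separates 1≉-1 σ τ σ≠τ λ v →
    trans (sym (eval≈⟦diag⟧ s∼σ v)) (trans (same v) (eval≈⟦diag⟧ t∼τ v))

theorem7p11 : ∀ {c ℓ} (R : RealField c ℓ) (n : ℕ) → 1 ≤ n →
    Σ (List (FullLinear n)) λ L →
      AllPairs (λ s t → ¬ SameOp R s t) L ×
      (∀ (t : FullLinear n) → Any (SameOp R t) L) ×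
      (+ (3 * length L) ≡ (+ (2 N.^ n)) - (-[1+ 0 ] Z.^ n))
theorem7p11 R n _ = map termWithSigns (charged n 1₃) , distinct , covered , counted
  where
  distinct : AllPairs (λ s t → ¬ SameOp R s t) (map termWithSigns (charged n 1₃))
  distinct = AllPairs.map⁺ (AllPairs.map
    (λ {p} {q} → ¬sameOp-if-differ R (hasSigns-termWithSigns p) (hasSigns-termWithSigns q))
    (charged-distinct n 1₃))

  covered : (t : FullLinear n) → Any (SameOp R t) (map termWithSigns (charged n 1₃))
  covered t = Any.map⁺ (Any.map
    (λ {q} σ≡q → sameOp-if-sameSigns R (hasSigns-signsOf t)
                   (subst (termWithSigns q HasSigns_) (≡.sym σ≡q) (hasSigns-termWithSigns q)))
    (charged-complete (signsOf t) (charge-signsOf t)))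

  counted : + (3 * length (map termWithSigns (charged n 1₃))) ≡ + (2 N.^ n) - (-[1+ 0 ] Z.^ n)
  counted = ≡.trans (cong (λ k → + (3 * k)) (length-map termWithSigns (charged n 1₃)))
            (≡.trans (3*length-charged n 1₃) (cong (+ (2 N.^ n) -_) (Z.*-identityʳ (Z.-1ℤ Z.^ n))))
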